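{- Let $n$ be a positive integer with $\gcd(n,6)=1$ having at least three distinct prime factors, let $G$ be a cyclic group of order $n$ and $g\in G$ with $\mathrm{ord}(g)=n$. Let $x_1,\dots,x_4\in[1,n-1]$ with $\gcd(n,x_1,x_2,x_3,x_4)=1$ be such that $S=(x_1g)(x_2g)(x_3g)(x_4g)$ is a minimal zero-sum sequence over $G$. Write $f(x_i)=\gcd(n,x_i)$. If $f(x_1)=5$, $\gcd(f(x_1),f(x_i))=1$ for $i=2,3,4$, and $5^2\nmid n$, then $\mathrm{ind}(S)=1$.
   Context: $G$ is written additively; sequences over $G$ are unordered finite sequences with repetition, written multiplicatively. A minimal zero-sum sequence is one whose terms sum to $0$ and no proper nontrivial subsequence sums to $0$. For a sequence $S=(n_1h)\cdot\ldots\cdot(n_kh)$ with $h$ a generator of $G$ and $1\le n_i\le|G|$, $\|S\|_h=(n_1+\cdots+n_k)/\mathrm{ord}(h)$, and $\mathrm{ind}(S)=\min\{\|S\|_h: \langle h\rangle=G\}$. -}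

module Defs where

open import Data.Nat using (ℕ; zero; suc; _+_; _*_; _≤_; _<_; NonZero)
open import Data.Nat.DivMod using (_%_)
open import Data.Nat.Divisibility using (_∣_)
open import Data.Nat.Primality using (Prime)
open import Data.Bool using (Bool; true; false)
open import Data.Vec using (Vec; []; _∷_; sum; zipWith)
open import Data.Vec.Relation.Unary.All using (All)
open import Data.Vec.Relation.Binary.Pointwise.Inductive using (Pointwise)
open import Data.Vec.Membership.Propositional using (_∈_)
open import Data.Product using (Σ; _×_; ∃; ∃-syntax)
open import Relation.Binary.PropositionalEquality using (_≡_; _≢_)
open import Relation.Nullary using (¬_)

-- The cyclic group G of order n is modelled as ℤ/nℤ, elements represented
-- by natural numbers, with equality in G being congruence mod n.
infix 4 _≡[_]_
_≡[_]_ : ℕ → (n : ℕ) → .{{NonZero n}} → ℕ → Set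
a ≡[ n ] b = a % n ≡ b % n

sumSel : ∀ {k} → Vec Bool k → Vec ℕ k → ℕ
sumSel [] [] = 0
sumSel (true ∷ T) (s ∷ S) = s + sumSel T S
sumSel (false ∷ T) (s ∷ S) = sumSel T S

ZeroSum : (n : ℕ) → .{{NonZero n}} → ∀ {k} → Vec ℕ k → Set
ZeroSum n S = sum S ≡[ n ] 0

-- minimal zero-sum sequence: nonempty, zero-sum, and no proper nontrivial
-- subsequence (subset T of positions with some selected and some omitted)
-- is zero-sum
MinimalZeroSum : (n : ℕ) → .{{NonZero n}} → ∀ {k} → Vec ℕ k → Set
MinimalZeroSum n {k} S =
  (0 < k) × ZeroSum n S ×
  ((T : Vec Bool k) → true ∈ T → false ∈ T → ¬ (sumSel T S ≡[ n ] 0))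

Generates : (n : ℕ) → .{{NonZero n}} → ℕ → Set
Generates n h = ∀ y → y < n → ∃[ m ] (m * h ≡[ n ] y)

Coeffs : (n : ℕ) → .{{NonZero n}} → ℕ → ∀ {k} → Vec ℕ k → Vec ℕ k → Set
Coeffs n h S c =
  All (λ cᵢ → 1 ≤ cᵢ × cᵢ ≤ n) c ×
  Pointwise (λ cᵢ sᵢ → cᵢ * h ≡[ n ] sᵢ) c S

-- ind(S) = 1, i.e. min over generators h of ‖S‖_h = (Σ cᵢ)/n equals 1:
-- it is attained (some generator has ‖S‖_h = 1) and is a lower bound
-- (every generator has ‖S‖_h ≥ 1).
IndIsOne : (n : ℕ) → .{{NonZero n}} → ∀ {k} → Vec ℕ k → Set
IndIsOne n S =
  (∃[ h ] Generates n h × ∃[ c ] (Coeffs n h S c × sum c ≡ n)) ×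
  (∀ h c → Generates n h → Coeffs n h S c → n ≤ sum c)

AtLeastThreePrimeFactors : ℕ → Set
AtLeastThreePrimeFactors n =
  ∃[ p ] ∃[ q ] ∃[ r ]
    (Prime p × Prime q × Prime r × p ≢ q × q ≢ r × p ≢ r ×
     p ∣ n × q ∣ n × r ∣ n)

{-# OPTIONS --safe #-}
-- Write n = 5m.  As gcd(n, x₁) = 5, some unit u has u x₁ ≡ 5, so S may be replaced by
-- T = 5 · y₂ y₃ y₄ with 5 ∤ yᵢ.  For any unit U the residues of U T are nonzero and sum to
-- n, 2n or 3n, and ind(S) = 1 as soon as the sum is n or 3n (for 3n use −U); so it suffices
-- to find a unit avoiding 2n.  Write each residue in base m as a m + r.  Multiplying by the
-- unit 1 + k m fixes every r and moves each leading digit a to a + k y (mod 5), so the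
-- residue sum is (Σ digits + R) m with R m = Σ r ∈ {m, 2m, 3m}.  Over k ∈ ℤ/5 the digit of
-- each yᵢ averages 2, so the five digit sums total 30 + 5R; for R ≤ 2 they cannot equal 10
-- at all four k with 1 + k m prime to 5.  For R = 3 the remainders are m − fᵢ with
-- f₂ + f₃ + f₄ = 5, and a finite search finds l ∈ {1, 2, 3} and k for which l (1 + k m) works.
module Submission where

open import Defs
open import Data.Nat
open import Data.Nat.Properties
open import Data.Nat.DivMod
open import Data.Nat.Divisibility
open import Data.Nat.Coprimality using (Coprime; gcd≡1⇒coprime; coprime-Bézout; coprime-divisor)
  renaming (sym to coprime-sym)
open import Data.Nat.GCD using (gcd; gcd[m,n]∣m; gcd[m,n]∣n; gcd-greatest; c*gcd[m,n]≡gcd[cm,cn]; module Bézout)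
open import Data.Nat.Primality
  using (Prime; prime?; prime[2]; ¬prime[0]; ¬prime[1]; composite[4]; composite[6]; composite⇒¬prime;
         euclidsLemma; prime⇒irreducible)
open import Data.Nat.Tactic.RingSolver using (solve-∀)
open import Data.Vec using (Vec; []; _∷_; map; sum)
open import Data.Vec.Properties using (map-cong; map-∘)
open import Data.Vec.Relation.Unary.All using (All; []; _∷_)
open import Data.Vec.Relation.Binary.Pointwise.Inductive using (Pointwise; []; _∷_)
open import Data.Product using (_×_; _,_; proj₁; proj₂; ∃-syntax)
open import Data.Sum using (_⊎_; inj₁; inj₂)
open import Relation.Nullary using (¬_; Dec; yes; no; ¬?; contradiction)
open import Relation.Nullary.Decidable using (_×-dec_; _→-dec_; from-yes; decidable-stable)
open import Relation.Binary.PropositionalEquality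

-- Units and residue sums modulo n

record Invertible (n : ℕ) .{{_ : NonZero n}} (u : ℕ) : Set where
  constructor invertible
  field
    inverse : ℕ
    inverse-correct : u * inverse ≡[ n ] 1

residues : (n : ℕ) .{{_ : NonZero n}} → ℕ → ∀ {k} → Vec ℕ k → Vec ℕ k
residues n u = map (λ s → u * s % n)

module _ {n : ℕ} .{{_ : NonZero n}} where

  %-≡[] : ∀ a → a % n ≡[ n ] a
  %-≡[] a = m%n%n≡m%n a n

  +-cong-≡[] : ∀ {a b c d} → a ≡[ n ] b → c ≡[ n ] d → a + c ≡[ n ] b + d
  +-cong-≡[] {a} {b} {c} {d} a≡b c≡d = begin
    (a + c) % n           ≡⟨ %-distribˡ-+ a c n ⟩
    (a % n + c % n) % n   ≡⟨ cong₂ (λ x y → (x + y) % n) a≡b c≡d ⟩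
    (b % n + d % n) % n   ≡⟨ %-distribˡ-+ b d n ⟨
    (b + d) % n           ∎
    where open ≡-Reasoning

  *-cong-≡[] : ∀ {a b c d} → a ≡[ n ] b → c ≡[ n ] d → a * c ≡[ n ] b * d
  *-cong-≡[] {a} {b} {c} {d} a≡b c≡d = begin
    (a * c) % n           ≡⟨ %-distribˡ-* a c n ⟩
    (a % n * (c % n)) % n ≡⟨ cong₂ (λ x y → (x * y) % n) a≡b c≡d ⟩
    (b % n * (d % n)) % n ≡⟨ %-distribˡ-* b d n ⟨
    (b * d) % n           ∎
    where open ≡-Reasoning

  *-congˡ-≡[] : ∀ u {a b} → a ≡[ n ] b → u * a ≡[ n ] u * b
  *-congˡ-≡[] u = *-cong-≡[] {u} {u} refl

  +-multiple-≡[] : ∀ a k → a + k * n ≡[ n ] a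
  +-multiple-≡[] a k = [m+kn]%n≡m%n a k n

  ≡[]0⇒n≤ : ∀ {a} → 0 < a → a ≡[ n ] 0 → n ≤ a
  ≡[]0⇒n≤ {a} 0<a a≡0 = ∣⇒≤ {{>-nonZero 0<a}} (m%n≡0⇒n∣m a n (trans a≡0 (m<n⇒m%n≡m (>-nonZero⁻¹ n))))

  invertible-* : ∀ {u v} → Invertible n u → Invertible n v → Invertible n (u * v)
  invertible-* {u} {v} (invertible u⁻¹ uu⁻¹≡1) (invertible v⁻¹ vv⁻¹≡1) = invertible (v⁻¹ * u⁻¹) (begin
    (u * v * (v⁻¹ * u⁻¹)) % n   ≡⟨ cong (_% n) (regroup u v v⁻¹ u⁻¹) ⟩
    (u * (v * v⁻¹) * u⁻¹) % n   ≡⟨ *-cong-≡[] (*-congˡ-≡[] u vv⁻¹≡1) refl ⟩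
    (u * 1 * u⁻¹) % n           ≡⟨ cong (λ x → (x * u⁻¹) % n) (*-identityʳ u) ⟩
    (u * u⁻¹) % n               ≡⟨ uu⁻¹≡1 ⟩
    1 % n                       ∎)
    where
    open ≡-Reasoning
    regroup : ∀ a b c d → a * b * (c * d) ≡ a * (b * c) * d
    regroup = solve-∀

  invertible⇒coprime : ∀ {u} → Invertible n u → Coprime u n
  invertible⇒coprime {u} (invertible u⁻¹ uu⁻¹≡1) {d} (d∣u , d∣n) = ∣1⇒≡1 d∣1
    where
    d∣1%n : d ∣ 1 % n
    d∣1%n = subst (d ∣_) uu⁻¹≡1 (%-presˡ-∣ (∣m⇒∣m*n u⁻¹ d∣u) d∣n)
    d∣1 : d ∣ 1
    d∣1 = subst (d ∣_) (sym (m≡m%n+[m/n]*n 1 n)) (∣m∣n⇒∣m+n d∣1%n (∣n⇒∣m*n (1 / n) d∣n))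

  -- opaque: unfolding the Bézout computation during unification is prohibitively slow
  opaque
    coprime⇒invertible : ∀ {u} → Coprime u n → Invertible n u
    coprime⇒invertible {u} c with coprime-Bézout c
    ... | Bézout.+- x y 1+yn≡xu = invertible x (begin
      (u * x) % n       ≡⟨ cong (_% n) (trans (*-comm u x) (sym 1+yn≡xu)) ⟩
      (1 + y * n) % n   ≡⟨ +-multiple-≡[] 1 y ⟩
      1 % n             ∎)
      where open ≡-Reasoning
    ... | Bézout.-+ x y 1+xu≡yn = invertible (x * pred n) (begin
      (u * (x * pred n)) % n               ≡⟨ +-multiple-≡[] _ 1 ⟨
      (u * (x * pred n) + 1 * n) % n       ≡⟨ cong (_% n) lift ⟩
      (1 + y * pred n * n) % n             ≡⟨ +-multiple-≡[] 1 (y * pred n) ⟩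
      1 % n                                ∎)
      where
      open ≡-Reasoning
      -- the inverse of u is -x, i.e. x (n - 1)
      lift : u * (x * pred n) + 1 * n ≡ 1 + y * pred n * n
      lift = begin
        u * (x * pred n) + 1 * n           ≡⟨ cong (λ t → u * (x * pred n) + 1 * t) (suc-pred n) ⟨
        u * (x * pred n) + 1 * suc (pred n) ≡⟨ expand u x (pred n) ⟩
        (1 + x * u) * pred n + 1           ≡⟨ cong (λ t → t * pred n + 1) 1+xu≡yn ⟩
        y * n * pred n + 1                 ≡⟨ collect y n (pred n) ⟩
        1 + y * pred n * n                 ∎
        where
        expand : ∀ u x p → u * (x * p) + 1 * suc p ≡ (1 + x * u) * p + 1
        expand = solve-∀
        collect : ∀ y n p → y * n * p + 1 ≡ 1 + y * p * n
        collect = solve-∀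

  cancel-≡[] : ∀ {u u⁻¹} → u * u⁻¹ ≡[ n ] 1 → ∀ s → u * s * u⁻¹ ≡[ n ] s
  cancel-≡[] {u} {u⁻¹} uu⁻¹≡1 s = begin
    (u * s * u⁻¹) % n   ≡⟨ cong (_% n) (swap u s u⁻¹) ⟩
    (s * (u * u⁻¹)) % n ≡⟨ *-congˡ-≡[] s uu⁻¹≡1 ⟩
    (s * 1) % n         ≡⟨ cong (_% n) (*-identityʳ s) ⟩
    s % n               ∎
    where
    open ≡-Reasoning
    swap : ∀ u s v → u * s * v ≡ s * (u * v)
    swap = solve-∀

  invertible-*-%≢0 : ∀ {u s} → Invertible n u → s % n ≢ 0 → u * s % n ≢ 0
  invertible-*-%≢0 {u} {s} (invertible u⁻¹ uu⁻¹≡1) s≢0 us≡0 = s≢0 (begin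
    s % n                    ≡⟨ cancel-≡[] {u} {u⁻¹} uu⁻¹≡1 s ⟨
    (u * s * u⁻¹) % n        ≡⟨ *-cong-≡[] (%-≡[] (u * s)) refl ⟨
    (u * s % n * u⁻¹) % n    ≡⟨ cong (λ x → (x * u⁻¹) % n) us≡0 ⟩
    0 % n                    ≡⟨ m<n⇒m%n≡m (>-nonZero⁻¹ n) ⟩
    0                        ∎)
    where open ≡-Reasoning

  n∸1*-% : ∀ z → z % n ≢ 0 → (n ∸ 1) * z % n ≡ n ∸ z % n
  n∸1*-% z z≢0 = begin
    (n ∸ 1) * z % n                    ≡⟨ *-congˡ-≡[] (n ∸ 1) (%-≡[] z) ⟨
    (n ∸ 1) * r % n                    ≡⟨ cong (_% n) (negate (m%n≤n z n) 0<r) ⟨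
    (n ∸ r + (r ∸ 1) * n) % n          ≡⟨ +-multiple-≡[] (n ∸ r) (r ∸ 1) ⟩
    (n ∸ r) % n                        ≡⟨ m<n⇒m%n≡m (∸-monoʳ-< 0<r (m%n≤n z n)) ⟩
    n ∸ r                              ∎
    where
    open ≡-Reasoning
    r = z % n
    0<r : 0 < r
    0<r = n≢0⇒n>0 z≢0
    negate : ∀ {r} → r ≤ n → 0 < r → n ∸ r + (r ∸ 1) * n ≡ (n ∸ 1) * r
    negate {suc r'} r≤n _ with d , refl ← m≤n⇒∃[o]m+o≡n r≤n
      rewrite m+n∸m≡n (suc r') d = identity r' d
      where
      identity : ∀ r' d → d + r' * (suc r' + d) ≡ (r' + d) * suc r'
      identity = solve-∀

  invertible-n∸1 : 1 < n → Invertible n (n ∸ 1)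
  invertible-n∸1 1<n = invertible (n ∸ 1) (begin
    (n ∸ 1) * (n ∸ 1) % n    ≡⟨ n∸1*-% (n ∸ 1) n∸1%n≢0 ⟩
    n ∸ (n ∸ 1) % n          ≡⟨ cong (n ∸_) (m<n⇒m%n≡m n∸1<n) ⟩
    n ∸ (n ∸ 1)              ≡⟨ m∸[m∸n]≡n (<⇒≤ 1<n) ⟩
    1                        ≡⟨ m<n⇒m%n≡m 1<n ⟨
    1 % n                    ∎)
    where
    open ≡-Reasoning
    n∸1<n : n ∸ 1 < n
    n∸1<n = ∸-monoʳ-< z<s (<⇒≤ 1<n)
    n∸1%n≢0 : (n ∸ 1) % n ≢ 0
    n∸1%n≢0 eq = >⇒≢ (m<n⇒0<n∸m 1<n) (trans (sym (m<n⇒m%n≡m n∸1<n)) eq)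

  generates-inverse : ∀ {u u⁻¹} → u * u⁻¹ ≡[ n ] 1 → Generates n u⁻¹
  generates-inverse {u} {u⁻¹} uu⁻¹≡1 y _ = u * y , cancel-≡[] {u} {u⁻¹} uu⁻¹≡1 y

  coeffs-residues : ∀ {k u u⁻¹} {S : Vec ℕ k} → u * u⁻¹ ≡[ n ] 1 →
    All (λ s → s % n ≢ 0) S → Coeffs n u⁻¹ S (residues n u S)
  coeffs-residues uu⁻¹≡1 [] = [] , []
  coeffs-residues {u = u} {u⁻¹} {s ∷ S} uu⁻¹≡1 (s≢0 ∷ S≢0)
    with bounds , congruences ← coeffs-residues {u = u} {u⁻¹} {S} uu⁻¹≡1 S≢0 =
    ((n≢0⇒n>0 us≢0 , m%n≤n (u * s) n) ∷ bounds) , (coefficient ∷ congruences)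
    where
    us≢0 : u * s % n ≢ 0
    us≢0 = invertible-*-%≢0 {u} (invertible u⁻¹ uu⁻¹≡1) s≢0
    coefficient : u * s % n * u⁻¹ ≡[ n ] s
    coefficient = trans (*-cong-≡[] {u * s % n} {u * s} {u⁻¹} (%-≡[] (u * s)) refl)
                        (cancel-≡[] {u} {u⁻¹} uu⁻¹≡1 s)

  sum-coeffs : ∀ {k h} {c S : Vec ℕ k} → Pointwise (λ cᵢ sᵢ → cᵢ * h ≡[ n ] sᵢ) c S →
    sum c * h ≡[ n ] sum S
  sum-coeffs [] = refl
  sum-coeffs {h = h} {c ∷ C} (c≡s ∷ C≡S) =
    trans (cong (_% n) (*-distribʳ-+ h c (sum C))) (+-cong-≡[] c≡s (sum-coeffs C≡S))

  n≤sum-coeffs : ∀ {k h} {S c : Vec ℕ (suc k)} → ZeroSum n S → Generates n h →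
    Coeffs n h S c → n ≤ sum c
  n≤sum-coeffs {h = h} {S} {c ∷ C} ΣS≡0 generates ((1≤c , _) ∷ _ , c≡S) =
    ≡[]0⇒n≤ (≤-trans 1≤c (m≤m+n c (sum C))) Σc≡0
    where
    open ≡-Reasoning
    M = proj₁ (generates (1 % n) (m%n<n 1 n))
    Mh≡1 : M * h ≡[ n ] 1
    Mh≡1 = trans (proj₂ (generates (1 % n) (m%n<n 1 n))) (%-≡[] 1)
    Σc≡0 : sum (c ∷ C) ≡[ n ] 0
    Σc≡0 = begin
      sum (c ∷ C) % n              ≡⟨ cong (_% n) (*-identityʳ _) ⟨
      sum (c ∷ C) * 1 % n          ≡⟨ *-congˡ-≡[] (sum (c ∷ C)) Mh≡1 ⟨
      sum (c ∷ C) * (M * h) % n    ≡⟨ cong (_% n) (*-assoc (sum (c ∷ C)) M h) ⟨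
      sum (c ∷ C) * M * h % n      ≡⟨ cong (λ x → x * h % n) (*-comm (sum (c ∷ C)) M) ⟩
      M * sum (c ∷ C) * h % n      ≡⟨ cong (_% n) (*-assoc M (sum (c ∷ C)) h) ⟩
      M * (sum (c ∷ C) * h) % n    ≡⟨ *-congˡ-≡[] M (sum-coeffs c≡S) ⟩
      M * sum S % n                ≡⟨ *-congˡ-≡[] M ΣS≡0 ⟩
      M * 0 % n                    ≡⟨ cong (_% n) (*-zeroʳ M) ⟩
      0 % n                        ∎

  sum-residues : ∀ {k} u (S : Vec ℕ k) → sum (residues n u S) ≡[ n ] u * sum S
  sum-residues u [] = cong (_% n) (sym (*-zeroʳ u))
  sum-residues u (s ∷ S) = trans (+-cong-≡[] (%-≡[] (u * s)) (sum-residues u S))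
                                 (cong (_% n) (sym (*-distribˡ-+ u s (sum S))))

  0<sum-residues : ∀ {k u} {S : Vec ℕ (suc k)} → Invertible n u → All (λ s → s % n ≢ 0) S →
    0 < sum (residues n u S)
  0<sum-residues {u = u} {s ∷ S} u-inv (s≢0 ∷ _) =
    ≤-trans (n≢0⇒n>0 (invertible-*-%≢0 {u} u-inv s≢0)) (m≤m+n _ _)

  sum-residues-negate : ∀ {k u} {S : Vec ℕ k} → Invertible n u → All (λ s → s % n ≢ 0) S →
    sum (residues n ((n ∸ 1) * u) S) + sum (residues n u S) ≡ k * n
  sum-residues-negate {u = u} {[]} _ [] = refl
  sum-residues-negate {suc k} {u} {s ∷ S} u-inv (s≢0 ∷ S≢0) = begin
    (n ∸ 1) * u * s % n + Σ⁻ + (u * s % n + Σ)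
      ≡⟨ cong (λ x → x % n + Σ⁻ + (u * s % n + Σ)) (*-assoc (n ∸ 1) u s) ⟩
    (n ∸ 1) * (u * s) % n + Σ⁻ + (u * s % n + Σ)
      ≡⟨ cong (λ x → x + Σ⁻ + (u * s % n + Σ)) (n∸1*-% (u * s) us≢0) ⟩
    n ∸ u * s % n + Σ⁻ + (u * s % n + Σ)
      ≡⟨ interchange (n ∸ u * s % n) Σ⁻ (u * s % n) Σ ⟩
    (n ∸ u * s % n + u * s % n) + (Σ⁻ + Σ)
      ≡⟨ cong₂ _+_ (m∸n+n≡m (m%n≤n (u * s) n)) (sum-residues-negate u-inv S≢0) ⟩
    n + k * n ∎
    where
    open ≡-Reasoning
    Σ⁻ = sum (residues n ((n ∸ 1) * u) S)
    Σ = sum (residues n u S)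
    us≢0 : u * s % n ≢ 0
    us≢0 = invertible-*-%≢0 {u} u-inv s≢0
    interchange : ∀ a b c d → a + b + (c + d) ≡ (a + c) + (b + d)
    interchange = solve-∀

  sum-map-% : ∀ {k} (S : Vec ℕ k) → sum (map (_% n) S) ≡[ n ] sum S
  sum-map-% [] = refl
  sum-map-% (s ∷ S) = +-cong-≡[] (%-≡[] s) (sum-map-% S)

  residues-* : ∀ u v {k} (S : Vec ℕ k) → residues n (u * v) S ≡ residues n u (map (v *_) S)
  residues-* u v S = trans (map-cong (λ s → cong (_% n) (*-assoc u v s)) S) (map-∘ _ _ S)

  residues-∘ : ∀ U u {k} (S : Vec ℕ k) → residues n U (residues n u S) ≡ residues n (U * u) S
  residues-∘ U u S = trans (sym (map-∘ _ _ S))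
    (map-cong (λ s → trans (*-congˡ-≡[] U (%-≡[] (u * s))) (cong (_% n) (sym (*-assoc U u s)))) S)

  zeroSum-residues : ∀ u {k} {S : Vec ℕ k} → ZeroSum n S → ZeroSum n (residues n u S)
  zeroSum-residues u {S = S} ΣS≡0 = trans (sum-residues u S) (trans (*-congˡ-≡[] u ΣS≡0) (cong (_% n) (*-zeroʳ u)))

  %≢0-of-bounds : ∀ {x} → 1 ≤ x × x ≤ n ∸ 1 → x % n ≢ 0
  %≢0-of-bounds {x} (1≤x , x≤n∸1) x%n≡0 = contradiction (trans (sym (m<n⇒m%n≡m x<n)) x%n≡0) (>⇒≢ 1≤x)
    where
    x<n : x < n
    x<n = ≤-<-trans x≤n∸1 (∸-monoʳ-< z<s (>-nonZero⁻¹ n))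

  indIsOne-of-residues : ∀ {k u} {S : Vec ℕ (suc k)} → ZeroSum n S → All (λ s → s % n ≢ 0) S →
    Invertible n u → sum (residues n u S) ≡ n → IndIsOne n S
  indIsOne-of-residues {u = u} {S} ΣS≡0 S≢0 (invertible u⁻¹ uu⁻¹≡1) Σ≡n =
    (u⁻¹ , generates-inverse {u} uu⁻¹≡1 , residues n u S , coeffs-residues {u = u} uu⁻¹≡1 S≢0 , Σ≡n) ,
    λ _ _ generates coeffs → n≤sum-coeffs ΣS≡0 generates coeffs

  multiple<4n : ∀ {a} → a ≡[ n ] 0 → 0 < a → a < 4 * n → a ≡ n ⊎ a ≡ 2 * n ⊎ a ≡ 3 * n
  multiple<4n {a} a≡0 0<a a<4n = cases (a / n) a≡[a/n]n (*-cancelʳ-< n (a / n) 4 (subst (_< 4 * n) a≡[a/n]n a<4n))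
    where
    a≡[a/n]n : a ≡ a / n * n
    a≡[a/n]n = sym (m/n*n≡m (m%n≡0⇒n∣m a n (trans a≡0 (m<n⇒m%n≡m (>-nonZero⁻¹ n)))))
    cases : ∀ j → a ≡ j * n → j < 4 → a ≡ n ⊎ a ≡ 2 * n ⊎ a ≡ 3 * n
    cases 0 refl _ = contradiction 0<a (<-irrefl refl)
    cases 1 a≡n _ = inj₁ (trans a≡n (*-identityˡ n))
    cases 2 a≡2n _ = inj₂ (inj₁ a≡2n)
    cases 3 a≡3n _ = inj₂ (inj₂ a≡3n)
    cases (suc (suc (suc (suc _)))) _ (s≤s (s≤s (s≤s (s≤s ()))))

  -- the residue sum is n, 2n or 3n, and negating u turns 3n into 4n − 3n = n
  indIsOne-of-residues≢2n : ∀ {u} {S : Vec ℕ 4} → 1 < n → ZeroSum n S → All (λ s → s % n ≢ 0) S →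
    Invertible n u → sum (residues n u S) ≢ 2 * n → IndIsOne n S
  indIsOne-of-residues≢2n {u} {S} 1<n ΣS≡0 S≢0 u-inv Σ≢2n =
    conclude (multiple<4n Σ≡0 (0<sum-residues u-inv S≢0) Σ<4n)
    where
    Σ = sum (residues n u S)
    Σ⁻ = sum (residues n ((n ∸ 1) * u) S)
    Σ≡0 : Σ ≡[ n ] 0
    Σ≡0 = trans (sum-residues u S) (trans (*-congˡ-≡[] u ΣS≡0) (cong (_% n) (*-zeroʳ u)))
    Σ<4n : Σ < 4 * n
    Σ<4n = subst (Σ <_) (trans (+-comm Σ Σ⁻) (sum-residues-negate u-inv S≢0))
             (m<m+n Σ (0<sum-residues (invertible-* (invertible-n∸1 1<n) u-inv) S≢0))
    conclude : Σ ≡ n ⊎ Σ ≡ 2 * n ⊎ Σ ≡ 3 * n → IndIsOne n S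
    conclude (inj₁ Σ≡n) = indIsOne-of-residues ΣS≡0 S≢0 u-inv Σ≡n
    conclude (inj₂ (inj₁ Σ≡2n)) = contradiction Σ≡2n Σ≢2n
    conclude (inj₂ (inj₂ Σ≡3n)) =
      indIsOne-of-residues {u = (n ∸ 1) * u} ΣS≡0 S≢0 (invertible-* (invertible-n∸1 1<n) u-inv)
        (+-cancelʳ-≡ (3 * n) Σ⁻ n (trans (cong (Σ⁻ +_) (sym Σ≡3n)) (sum-residues-negate u-inv S≢0)))


coprime-* : ∀ {u a b} → Coprime u a → Coprime u b → Coprime u (a * b)
coprime-* {u} {a} {b} u⊥a u⊥b {d} (d∣u , d∣ab) = u⊥b (d∣u , coprime-divisor d⊥a d∣ab)
  where
  d⊥a : Coprime d a
  d⊥a (i∣d , i∣a) = u⊥a (∣-trans i∣d d∣u , i∣a)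

prime∤⇒coprime : ∀ {p u} → Prime p → ¬ p ∣ u → Coprime u p
prime∤⇒coprime p-prime p∤u {d} (d∣u , d∣p) with prime⇒irreducible p-prime d∣p
... | inj₁ d≡1 = d≡1
... | inj₂ refl = contradiction d∣u p∤u

∤-of-gcd≡1 : ∀ {d n x} → d ≢ 1 → d ∣ n → gcd d (gcd n x) ≡ 1 → ¬ d ∣ x
∤-of-gcd≡1 {d} d≢1 d∣n gcd≡1 d∣x =
  d≢1 (∣1⇒≡1 (subst (d ∣_) gcd≡1 (gcd-greatest ∣-refl (gcd-greatest d∣n d∣x))))

-- Shifting the leading digits

-- the leading base-m digit of (1 + k m) z modulo 5m, for z = a m + r with z ≡ d (mod 5)
shifted : ℕ → ℕ → ℕ → ℕ
shifted k a d = (a + k * d) % 5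

sum<5 : (ℕ → ℕ) → ℕ
sum<5 f = f 0 + f 1 + f 2 + f 3 + f 4

sum<5-cong : ∀ {f g} → (∀ k → f k ≡ g k) → sum<5 f ≡ sum<5 g
sum<5-cong f≡g = cong₂ _+_ (cong₂ _+_ (cong₂ _+_ (cong₂ _+_ (f≡g 0) (f≡g 1)) (f≡g 2)) (f≡g 3)) (f≡g 4)

sum<5-+ : ∀ f g → sum<5 (λ k → f k + g k) ≡ sum<5 f + sum<5 g
sum<5-+ f g = interchange (f 0) (f 1) (f 2) (f 3) (f 4) (g 0) (g 1) (g 2) (g 3) (g 4)
  where
  interchange : ∀ a b c d e a' b' c' d' e' →
    a + a' + (b + b') + (c + c') + (d + d') + (e + e') ≡ a + b + c + d + e + (a' + b' + c' + d' + e')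
  interchange = solve-∀

-- as k runs through ℤ/5, a + k d runs through all residues when 5 ∤ d
sum<5-shifted : ∀ a d → d % 5 ≢ 0 → sum<5 (λ k → shifted k a d) ≡ 10
sum<5-shifted a d d≢0 = trans (sum<5-cong reduce) (residues-check (m%n<n a 5) (m%n<n d 5) d≢0)
  where
  reduce : ∀ k → shifted k a d ≡ shifted k (a % 5) (d % 5)
  reduce k = sym (+-cong-≡[] {5} {a % 5} {a} (%-≡[] a) (*-congˡ-≡[] k {d % 5} {d} (%-≡[] d)))
  residues-check : ∀ {a} → a < 5 → ∀ {d} → d < 5 → d ≢ 0 → sum<5 (λ k → shifted k a d) ≡ 10
  residues-check = from-yes (allUpTo? (λ a → allUpTo? (λ d → ¬? (d ≟ 0) →-dec (sum<5 (λ k → shifted k a d) ≟ 10)) 5) 5)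

Admissible : ℕ → ℕ → Set
Admissible e k = (1 + k * e) % 5 ≢ 0

admissible? : ∀ e k → Dec (Admissible e k)
admissible? e k = ¬? ((1 + k * e) % 5 ≟ 0)

module _ (σ : ℕ → ℕ) (σ>0 : ∀ k → 0 < σ k) where

  -- for e ≢ 0 exactly one k < 5 is not admissible
  sum<5-forced>40 : ∀ {e} → e < 5 → e ≢ 0 → (∀ k → k < 5 → Admissible e k → σ k ≡ 10) → 40 < sum<5 σ
  sum<5-forced>40 {0} _ e≢0 _ = contradiction refl e≢0
  sum<5-forced>40 {1} _ _ forced
    rewrite forced 0 z<s (λ ()) | forced 1 (s≤s z<s) (λ ())
          | forced 2 (s≤s (s≤s z<s)) (λ ()) | forced 3 (s≤s (s≤s (s≤s z<s))) (λ ()) =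
    +-monoʳ-< 40 (σ>0 4)
  sum<5-forced>40 {2} _ _ forced
    rewrite forced 0 z<s (λ ()) | forced 1 (s≤s z<s) (λ ())
          | forced 3 (s≤s (s≤s (s≤s z<s))) (λ ()) | forced 4 (s≤s (s≤s (s≤s (s≤s z<s)))) (λ ()) =
    subst (40 <_) (middle (σ 2)) (+-monoʳ-< 40 (σ>0 2))
    where
    middle : ∀ x → 40 + x ≡ 10 + 10 + x + 10 + 10
    middle = solve-∀
  sum<5-forced>40 {3} _ _ forced
    rewrite forced 0 z<s (λ ()) | forced 1 (s≤s z<s) (λ ())
          | forced 2 (s≤s (s≤s z<s)) (λ ()) | forced 4 (s≤s (s≤s (s≤s (s≤s z<s)))) (λ ()) =
    subst (40 <_) (fourth (σ 3)) (+-monoʳ-< 40 (σ>0 3))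
    where
    fourth : ∀ x → 40 + x ≡ 10 + 10 + 10 + x + 10
    fourth = solve-∀
  sum<5-forced>40 {4} _ _ forced
    rewrite forced 0 z<s (λ ()) | forced 2 (s≤s (s≤s z<s)) (λ ())
          | forced 3 (s≤s (s≤s (s≤s z<s))) (λ ()) | forced 4 (s≤s (s≤s (s≤s (s≤s z<s)))) (λ ()) =
    subst (40 <_) (second (σ 1)) (+-monoʳ-< 40 (σ>0 1))
    where
    second : ∀ x → 40 + x ≡ 10 + x + 10 + 10 + 10
    second = solve-∀
  sum<5-forced>40 {suc (suc (suc (suc (suc _))))} (s≤s (s≤s (s≤s (s≤s (s≤s ()))))) _ _

  pigeonhole : ∀ {e} → e < 5 → e ≢ 0 → sum<5 σ ≤ 40 → ∃[ k ] (k < 5 × Admissible e k × σ k ≢ 10)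
  pigeonhole {e} e<5 e≢0 Σσ≤40 with anyUpTo? (λ k → admissible? e k ×-dec ¬? (σ k ≟ 10)) 5
  ... | yes (k , k<5 , admissible , σk≢10) = k , k<5 , admissible , σk≢10
  ... | no none = contradiction Σσ≤40 (<⇒≱ (sum<5-forced>40 e<5 e≢0 forced))
    where
    forced : ∀ k → k < 5 → Admissible e k → σ k ≡ 10
    forced k k<5 admissible = decidable-stable (σ k ≟ 10) λ σk≢10 → none (k , k<5 , admissible , σk≢10)

-- The case R = 3

≤3-of-sum≡5 : ∀ {a b c} → a + b + c ≡ 5 → 0 < b → 0 < c → a ≤ 3
≤3-of-sum≡5 {a} {b} {c} a+b+c≡5 0<b 0<c = +-cancelʳ-≤ 2 a 3 (begin
  a + 2       ≡⟨ +-assoc a 1 1 ⟨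
  a + 1 + 1   ≤⟨ +-mono-≤ (+-monoʳ-≤ a 0<b) 0<c ⟩
  a + b + c   ≡⟨ a+b+c≡5 ⟩
  5           ∎)
  where open ≤-Reasoning

-- the shifted digit of l y for y = (q + 1) m − f and e = m mod 5:
-- l y = (l (q + 1) − 1) m + (m − l f) and y ≡ (q + 1) e + 5 − f (mod 5)
scaledDigit : ℕ → ℕ → ℕ → ℕ → ℕ → ℕ
scaledDigit e l k q f = shifted k (l * suc q ∸ 1) (l * (suc q * e + (5 ∸ f)))

ScaledSearch : ℕ → ℕ → ℕ → ℕ → ℕ → ℕ → ℕ → Set
ScaledSearch e q₂ q₃ q₄ f₂ f₃ f₄ =
  e ≢ 0 → f₂ ≢ 0 → f₃ ≢ 0 → f₄ ≢ 0 → f₂ + f₃ + f₄ ≡ 5 →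
  ∃[ l ] (l < 3 × ∃[ k ] (k < 5 × Admissible e k ×
    scaledDigit e (suc l) k q₂ f₂ + scaledDigit e (suc l) k q₃ f₃ + scaledDigit e (suc l) k q₄ f₄ ≢ 7))

-- decided by evaluation; opaque so that uses do not re-run the search
opaque
  scaled-search : ∀ {e} → e < 5 → ∀ {q₂} → q₂ < 5 → ∀ {q₃} → q₃ < 5 → ∀ {q₄} → q₄ < 5 →
    ∀ {f₂} → f₂ < 4 → ∀ {f₃} → f₃ < 4 → ∀ {f₄} → f₄ < 4 → ScaledSearch e q₂ q₃ q₄ f₂ f₃ f₄
  scaled-search = from-yes
    (allUpTo? (λ e → allUpTo? (λ q₂ → allUpTo? (λ q₃ → allUpTo? (λ q₄ →
     allUpTo? (λ f₂ → allUpTo? (λ f₃ → allUpTo? (λ f₄ → search e q₂ q₃ q₄ f₂ f₃ f₄) 4) 4) 4) 5) 5) 5) 5)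
    where
    search : ∀ e q₂ q₃ q₄ f₂ f₃ f₄ → Dec (ScaledSearch e q₂ q₃ q₄ f₂ f₃ f₄)
    search e q₂ q₃ q₄ f₂ f₃ f₄ =
      ¬? (e ≟ 0) →-dec ¬? (f₂ ≟ 0) →-dec ¬? (f₃ ≟ 0) →-dec ¬? (f₄ ≟ 0) →-dec (f₂ + f₃ + f₄ ≟ 5) →-dec
      anyUpTo? (λ l → anyUpTo? (λ k → admissible? e k ×-dec
        ¬? (scaledDigit e (suc l) k q₂ f₂ + scaledDigit e (suc l) k q₃ f₃ + scaledDigit e (suc l) k q₄ f₄ ≟ 7)) 5) 3

-- Residues modulo 5m in base m

module _ (m : ℕ) .{{_ : NonZero m}} .{{_ : NonZero (m * 5)}} where

  digits<m*5 : ∀ a {r} → r < m → a % 5 * m + r < m * 5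
  digits<m*5 a {r} r<m = begin-strict
    a % 5 * m + r    <⟨ +-monoʳ-< (a % 5 * m) r<m ⟩
    a % 5 * m + m    ≡⟨ +-comm (a % 5 * m) m ⟩
    suc (a % 5) * m  ≤⟨ *-monoˡ-≤ m (m%n<n a 5) ⟩
    5 * m            ≡⟨ *-comm 5 m ⟩
    m * 5            ∎
    where open ≤-Reasoning

  %-digits : ∀ a r → r < m → (a * m + r) % (m * 5) ≡ a % 5 * m + r
  %-digits a r r<m = begin
    (a * m + r) % (m * 5)                        ≡⟨ cong (λ x → (x * m + r) % (m * 5)) (m≡m%n+[m/n]*n a 5) ⟩
    ((a % 5 + a / 5 * 5) * m + r) % (m * 5)      ≡⟨ cong (_% (m * 5)) (regroup (a % 5) (a / 5) m r) ⟩
    (a % 5 * m + r + a / 5 * (m * 5)) % (m * 5)  ≡⟨ +-multiple-≡[] {m * 5} (a % 5 * m + r) (a / 5) ⟩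
    (a % 5 * m + r) % (m * 5)                    ≡⟨ m<n⇒m%n≡m (digits<m*5 a r<m) ⟩
    a % 5 * m + r                                ∎
    where
    open ≡-Reasoning
    regroup : ∀ a b m r → (a + b * 5) * m + r ≡ a * m + r + b * (m * 5)
    regroup = solve-∀

  shift-digit : ∀ k z → (1 + k * m) * z % (m * 5) ≡ shifted k (z / m) z * m + z % m
  shift-digit k z = begin
    (1 + k * m) * z % (m * 5)                ≡⟨ cong (_% (m * 5)) (spread k z m) ⟩
    (z + k * z * m) % (m * 5)                ≡⟨ cong (λ x → (x + k * z * m) % (m * 5)) (m≡m%n+[m/n]*n z m) ⟩
    (z % m + z / m * m + k * z * m) % (m * 5) ≡⟨ cong (_% (m * 5)) (collect (z % m) (z / m) (k * z) m) ⟩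
    ((z / m + k * z) * m + z % m) % (m * 5)  ≡⟨ %-digits (z / m + k * z) (z % m) (m%n<n z m) ⟩
    shifted k (z / m) z * m + z % m          ∎
    where
    open ≡-Reasoning
    spread : ∀ k z m → (1 + k * m) * z ≡ z + k * z * m
    spread = solve-∀
    collect : ∀ r q a m → r + q * m + a * m ≡ (q + a) * m + r
    collect = solve-∀

  /-%-digits : ∀ a r → r < m → (a * m + r) / m ≡ a × (a * m + r) % m ≡ r
  /-%-digits a r r<m =
    trans (+-distrib-/-∣ˡ r (n∣m*n a)) (trans (cong₂ _+_ (m*n/n≡m a m) (m<n⇒m/n≡0 r<m)) (+-identityʳ a)) ,
    trans (cong (_% m) (+-comm (a * m) r)) (trans (+-multiple-≡[] r a) (m<n⇒m%n≡m r<m))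

  digitSum : ℕ → ∀ {j} → Vec ℕ j → ℕ
  digitSum k T = sum (map (λ t → shifted k (t / m) t) T)

  remainderSum : ∀ {j} → Vec ℕ j → ℕ
  remainderSum T = sum (map (_% m) T)

  sum-residues-shift : ∀ k {j} (T : Vec ℕ j) →
    sum (residues (m * 5) (1 + k * m) T) ≡ digitSum k T * m + remainderSum T
  sum-residues-shift k [] = refl
  sum-residues-shift k (t ∷ T) =
    trans (cong₂ _+_ (shift-digit k t) (sum-residues-shift k T))
          (interchange (shifted k (t / m) t) (t % m) (digitSum k T) (remainderSum T) m)
    where
    interchange : ∀ a r A R m → a * m + r + (A * m + R) ≡ (a + A) * m + (r + R)
    interchange = solve-∀

  sum<5-digitSum : ∀ {j} (T : Vec ℕ j) →
    sum<5 (λ k → digitSum k T) ≡ sum (map (λ t → sum<5 (λ k → shifted k (t / m) t)) T)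
  sum<5-digitSum [] = refl
  sum<5-digitSum (t ∷ T) =
    trans (sum<5-+ (λ k → shifted k (t / m) t) (λ k → digitSum k T)) (cong (_ +_) (sum<5-digitSum T))

  invertible-m*5 : ∀ {u} → Coprime u m → ¬ 5 ∣ u → Invertible (m * 5) u
  invertible-m*5 u⊥m 5∤u = coprime⇒invertible (coprime-* u⊥m (prime∤⇒coprime (from-yes (prime? 5)) 5∤u))

  invertible-shift : ∀ k → Admissible (m % 5) k → Invertible (m * 5) (1 + k * m)
  invertible-shift k admissible = invertible-m*5 (invertible⇒coprime (invertible 1 ≡1)) 5∤
    where
    ≡1 : (1 + k * m) * 1 ≡[ m ] 1
    ≡1 = trans (cong (_% m) (*-identityʳ (1 + k * m))) (+-multiple-≡[] 1 k)
    5∤ : ¬ 5 ∣ 1 + k * m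
    5∤ 5∣ = admissible (trans (+-cong-≡[] {5} {1} {1} {k * (m % 5)} {k * m} refl (*-congˡ-≡[] k (%-≡[] m)))
                              (n∣m⇒m%n≡0 _ 5 5∣))

  m%5≢0 : ¬ 25 ∣ m * 5 → m % 5 ≢ 0
  m%5≢0 25∤m*5 m%5≡0 = 25∤m*5 (*-monoˡ-∣ 5 (m%n≡0⇒n∣m m 5 m%5≡0))

  5∤-residue : ∀ {u x} → Invertible (m * 5) u → ¬ 5 ∣ x → u * x % (m * 5) % 5 ≢ 0
  5∤-residue {u} {x} u-inv 5∤x ux%5≡0 with euclidsLemma u x (from-yes (prime? 5)) 5∣ux
    where
    5∣ux : 5 ∣ u * x
    5∣ux = m%n≡0⇒n∣m (u * x) 5 (trans (sym (m∣n⇒o%n%m≡o%m 5 (m * 5) (u * x) (n∣m*n m))) ux%5≡0)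
  ... | inj₁ 5∣u = contradiction (invertible⇒coprime u-inv (5∣u , n∣m*n m)) λ ()
  ... | inj₂ 5∣x = contradiction 5∣x 5∤x

  lift-coprime-to-5 : m % 5 ≢ 0 → ∀ b → ∃[ u ] (u ≡[ m ] b × ¬ 5 ∣ u)
  lift-coprime-to-5 m%5≢0 b with 5 ∣? b
  ... | no 5∤b = b , refl , 5∤b
  ... | yes 5∣b = b + m , trans (cong (λ x → (b + x) % m) (sym (*-identityˡ m))) (+-multiple-≡[] b 1) ,
                  λ 5∣b+m → m%5≢0 (n∣m⇒m%n≡0 m 5 (∣m+n∣m⇒∣n 5∣b+m 5∣b))

  gcd[m,a]≡1 : ∀ {a} → gcd (m * 5) (a * 5) ≡ 5 → gcd m a ≡ 1
  gcd[m,a]≡1 {a} gcd[m*5,a*5]≡5 = *-cancelʳ-≡ (gcd m a) 1 5 (begin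
    gcd m a * 5           ≡⟨ *-comm (gcd m a) 5 ⟩
    5 * gcd m a           ≡⟨ c*gcd[m,n]≡gcd[cm,cn] 5 m a ⟩
    gcd (5 * m) (5 * a)   ≡⟨ cong₂ gcd (*-comm 5 m) (*-comm 5 a) ⟩
    gcd (m * 5) (a * 5)   ≡⟨ gcd[m*5,a*5]≡5 ⟩
    5                     ∎)
    where open ≡-Reasoning

  5-normalised : 1 < m → ∀ {u a} → u * a ≡[ m ] 1 → u * (a * 5) % (m * 5) ≡ 5
  5-normalised 1<m {u} {a} u*a≡1 = begin
    u * (a * 5) % (m * 5)                      ≡⟨ cong (_% (m * 5)) (*-assoc u a 5) ⟨
    u * a * 5 % (m * 5)                        ≡⟨ cong (λ x → x * 5 % (m * 5)) (m≡m%n+[m/n]*n (u * a) m) ⟩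
    ((u * a) % m + t * m) * 5 % (m * 5)        ≡⟨ cong (λ r → (r + t * m) * 5 % (m * 5)) (trans u*a≡1 (m<n⇒m%n≡m 1<m)) ⟩
    (1 + t * m) * 5 % (m * 5)                  ≡⟨ cong (_% (m * 5)) (expand t m) ⟩
    (5 + t * (m * 5)) % (m * 5)                ≡⟨ +-multiple-≡[] {m * 5} 5 t ⟩
    5 % (m * 5)                                ≡⟨ m<n⇒m%n≡m (≤-trans (s≤s (m≤n+m 5 4)) (*-monoˡ-≤ 5 1<m)) ⟩
    5                                          ∎
    where
    open ≡-Reasoning
    t = u * a / m
    expand : ∀ t m → (1 + t * m) * 5 ≡ 5 + t * (m * 5)
    expand = solve-∀

  normalising-unit-5* : 1 < m → m % 5 ≢ 0 → ∀ {a} → gcd (m * 5) (a * 5) ≡ 5 →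
    ∃[ u ] (Invertible (m * 5) u × u * (a * 5) % (m * 5) ≡ 5)
  normalising-unit-5* 1<m m%5≢0 {a} gcd[m*5,a*5]≡5 =
    lift (coprime⇒invertible (coprime-sym (gcd≡1⇒coprime (gcd[m,a]≡1 gcd[m*5,a*5]≡5))))
    where
    lift : Invertible m a → ∃[ u ] (Invertible (m * 5) u × u * (a * 5) % (m * 5) ≡ 5)
    lift (invertible a⁻¹ a*a⁻¹≡1) with u , u≡a⁻¹ , 5∤u ← lift-coprime-to-5 m%5≢0 a⁻¹ =
      u , invertible-m*5 (invertible⇒coprime (invertible a u*a≡1)) 5∤u , 5-normalised 1<m {u} {a} u*a≡1
      where
      u*a≡1 : u * a ≡[ m ] 1
      u*a≡1 = trans (*-cong-≡[] {m} {u} {a⁻¹} {a} {a} u≡a⁻¹ refl) (trans (cong (_% m) (*-comm a⁻¹ a)) a*a⁻¹≡1)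

  normalising-unit : 1 < m → m % 5 ≢ 0 → ∀ {x} → gcd (m * 5) x ≡ 5 →
    ∃[ u ] (Invertible (m * 5) u × u * x % (m * 5) ≡ 5)
  normalising-unit 1<m m%5≢0 {x} gcd[m*5,x]≡5 = via (subst (_∣ x) gcd[m*5,x]≡5 (gcd[m,n]∣n (m * 5) x))
    where
    via : 5 ∣ x → ∃[ u ] (Invertible (m * 5) u × u * x % (m * 5) ≡ 5)
    via (divides a x≡a*5) = subst (λ x → ∃[ u ] (Invertible (m * 5) u × u * x % (m * 5) ≡ 5)) (sym x≡a*5)
      (normalising-unit-5* 1<m m%5≢0 {a} (subst (λ x → gcd (m * 5) x ≡ 5) x≡a*5 gcd[m*5,x]≡5))

  module _ {y q f : ℕ} (y+f≡[1+q]m : y + f ≡ suc q * m) where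

    scaled-/-% : ∀ l → 0 < l → 0 < f → l * f ≤ m → (l * y) / m ≡ l * suc q ∸ 1 × (l * y) % m ≡ m ∸ l * f
    scaled-/-% l 0<l 0<f lf≤m = subst (λ x → x / m ≡ l * suc q ∸ 1 × x % m ≡ m ∸ l * f) (sym ly≡)
      (/-%-digits (l * suc q ∸ 1) (m ∸ l * f) (∸-monoʳ-< (*-mono-≤ 0<l 0<f) lf≤m))
      where
      open ≡-Reasoning
      ly≡ : l * y ≡ (l * suc q ∸ 1) * m + (m ∸ l * f)
      ly≡ = +-cancelʳ-≡ (l * f) _ _ (begin
        l * y + l * f                           ≡⟨ *-distribˡ-+ l y f ⟨
        l * (y + f)                             ≡⟨ cong (l *_) y+f≡[1+q]m ⟩
        l * (suc q * m)                         ≡⟨ *-assoc l (suc q) m ⟨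
        l * suc q * m                           ≡⟨ cong (_* m) (m∸n+n≡m (*-mono-≤ 0<l (s≤s (z≤n {q})))) ⟨
        (l * suc q ∸ 1 + 1) * m                 ≡⟨ +-*-distrib (l * suc q ∸ 1) m ⟩
        (l * suc q ∸ 1) * m + m                 ≡⟨ cong ((l * suc q ∸ 1) * m +_) (m∸n+n≡m lf≤m) ⟨
        (l * suc q ∸ 1) * m + (m ∸ l * f + l * f) ≡⟨ +-assoc ((l * suc q ∸ 1) * m) (m ∸ l * f) (l * f) ⟨
        (l * suc q ∸ 1) * m + (m ∸ l * f) + l * f ∎)
        where
        +-*-distrib : ∀ a m → (a + 1) * m ≡ a * m + m
        +-*-distrib = solve-∀

    scaled-≡[5] : f ≤ 5 → y ≡[ 5 ] suc q * (m % 5) + (5 ∸ f)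
    scaled-≡[5] f≤5 = begin
      y % 5                            ≡⟨ +-multiple-≡[] y 1 ⟨
      (y + 1 * 5) % 5                  ≡⟨ cong (λ x → (y + x) % 5) (m+[n∸m]≡n f≤5) ⟨
      (y + (f + (5 ∸ f))) % 5          ≡⟨ cong (_% 5) (+-assoc y f (5 ∸ f)) ⟨
      (y + f + (5 ∸ f)) % 5            ≡⟨ cong (λ x → (x + (5 ∸ f)) % 5) y+f≡[1+q]m ⟩
      (suc q * m + (5 ∸ f)) % 5
        ≡⟨ +-cong-≡[] {5} {suc q * (m % 5)} {suc q * m} {5 ∸ f} (*-congˡ-≡[] (suc q) {m % 5} {m} (%-≡[] m)) refl ⟨
      (suc q * (m % 5) + (5 ∸ f)) % 5  ∎
      where open ≡-Reasoning

    shifted-scaled : ∀ k l → 0 < l → 0 < f → f ≤ 5 → l * f ≤ m →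
      shifted k ((l * y) / m) (l * y) ≡ scaledDigit (m % 5) l k q f
    shifted-scaled k l 0<l 0<f f≤5 lf≤m =
      trans (cong (λ a → shifted k a (l * y)) (proj₁ (scaled-/-% l 0<l 0<f lf≤m)))
            (+-cong-≡[] {5} {l * suc q ∸ 1} {l * suc q ∸ 1} {k * (l * y)} {k * (l * D)} refl
              (*-congˡ-≡[] k {l * y} {l * D} (*-congˡ-≡[] l {y} {D} (scaled-≡[5] f≤5))))
      where
      D = suc q * (m % 5) + (5 ∸ f)

  module _ (15<m : 15 < m) (m%5≢0 : m % 5 ≢ 0) (2∤m : ¬ 2 ∣ m) (3∤m : ¬ 3 ∣ m)
           {y₂ y₃ y₄ : ℕ} (y₂<m*5 : y₂ < m * 5) (y₃<m*5 : y₃ < m * 5) (y₄<m*5 : y₄ < m * 5)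
           (y₂%5≢0 : y₂ % 5 ≢ 0) (y₃%5≢0 : y₃ % 5 ≢ 0) (y₄%5≢0 : y₄ % 5 ≢ 0)
           (ΣT≡0 : ZeroSum (m * 5) (5 ∷ y₂ ∷ y₃ ∷ y₄ ∷ [])) where

    T : Vec ℕ 4
    T = 5 ∷ y₂ ∷ y₃ ∷ y₄ ∷ []

    5<m : 5 < m
    5<m = ≤-trans (m≤n+m 6 10) 15<m

    sum<5-digitSum-T : sum<5 (λ k → digitSum k T) ≡ 30
    sum<5-digitSum-T = trans (sum<5-digitSum T) (cong₂ _+_ first
      (cong₂ _+_ (sum<5-shifted (y₂ / m) y₂ y₂%5≢0) (cong₂ _+_ (sum<5-shifted (y₃ / m) y₃ y₃%5≢0)
        (cong (_+ 0) (sum<5-shifted (y₄ / m) y₄ y₄%5≢0)))))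
      where
      first : sum<5 (λ k → shifted k (5 / m) 5) ≡ 0
      first = cong (λ a → sum<5 (λ k → shifted k a 5)) (m<n⇒m/n≡0 5<m)

    module _ (R : ℕ) (0<R : 0 < R) (R≤2 : R ≤ 2) (ΣT%m≡Rm : remainderSum T ≡ R * m) where

      σ : ℕ → ℕ
      σ k = digitSum k T + R

      sum-residues-σ : ∀ k → sum (residues (m * 5) (1 + k * m) T) ≡ σ k * m
      sum-residues-σ k = trans (sum-residues-shift k T)
        (trans (cong (digitSum k T * m +_) ΣT%m≡Rm) (sym (*-distribʳ-+ m (digitSum k T) R)))

      sum<5-σ≤40 : sum<5 σ ≤ 40
      sum<5-σ≤40 = begin
        sum<5 σ                                        ≡⟨ sum<5-+ (λ k → digitSum k T) (λ _ → R) ⟩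
        sum<5 (λ k → digitSum k T) + sum<5 (λ _ → R)   ≡⟨ cong (_+ sum<5 (λ _ → R)) sum<5-digitSum-T ⟩
        30 + sum<5 (λ _ → R)                           ≤⟨ +-monoʳ-≤ 30 (five-times R≤2) ⟩
        40                                             ∎
        where
        open ≤-Reasoning
        five-times : ∀ {R} → R ≤ 2 → R + R + R + R + R ≤ 10
        five-times z≤n = z≤n
        five-times (s≤s z≤n) = s≤s (s≤s (s≤s (s≤s (s≤s z≤n))))
        five-times (s≤s (s≤s z≤n)) = ≤-refl

      σ>0 : ∀ k → 0 < σ k
      σ>0 k = ≤-trans 0<R (m≤n+m R (digitSum k T))

      unit-when-R≤2 : ∃[ U ] (Invertible (m * 5) U × sum (residues (m * 5) U T) ≢ 2 * (m * 5))
      unit-when-R≤2 =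
        let k , _ , admissible , σk≢10 = pigeonhole σ σ>0 (m%n<n m 5) m%5≢0 sum<5-σ≤40
        in 1 + k * m , invertible-shift k admissible ,
           λ Σ≡2n → σk≢10 (*-cancelʳ-≡ (σ k) 10 m (trans (sym (sum-residues-σ k)) (trans Σ≡2n (2*[m*5] m))))
        where
        2*[m*5] : ∀ m → 2 * (m * 5) ≡ 10 * m
        2*[m*5] = solve-∀

    invertible-small : ∀ l → l < 3 → Invertible (m * 5) (suc l)
    invertible-small l l<3 = invertible-m*5 (coprime l l<3) λ 5∣ → <⇒≱ (≤-trans (s≤s l<3) (n≤1+n 4)) (∣⇒≤ 5∣)
      where
      coprime : ∀ l → l < 3 → Coprime (suc l) m
      coprime 0 _ (d∣1 , _) = ∣1⇒≡1 d∣1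
      coprime 1 _ = coprime-sym (prime∤⇒coprime prime[2] 2∤m)
      coprime 2 _ = coprime-sym (prime∤⇒coprime (from-yes (prime? 3)) 3∤m)
      coprime (suc (suc (suc _))) (s≤s (s≤s (s≤s ())))

    module _ (ΣT%m≡3m : remainderSum T ≡ 3 * m) where

      q f : ℕ → ℕ
      q y = y / m
      f y = m ∸ y % m

      y+f≡[1+q]m : ∀ y → y + f y ≡ suc (q y) * m
      y+f≡[1+q]m y = begin
        y + f y                      ≡⟨ cong (_+ f y) (m≡m%n+[m/n]*n y m) ⟩
        y % m + q y * m + f y        ≡⟨ swap (y % m) (q y * m) (f y) ⟩
        q y * m + (y % m + f y)      ≡⟨ cong (q y * m +_) (m+[n∸m]≡n (m%n≤n y m)) ⟩
        q y * m + m                  ≡⟨ +-comm (q y * m) m ⟩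
        suc (q y) * m                ∎
        where
        open ≡-Reasoning
        swap : ∀ a b c → a + b + c ≡ b + (a + c)
        swap = solve-∀

      0<f : ∀ y → 0 < f y
      0<f y = m<n⇒0<n∸m (m%n<n y m)

      Σf≡5 : f y₂ + f y₃ + f y₄ ≡ 5
      Σf≡5 = +-cancelˡ-≡ Σr _ 5 (begin
        Σr + (f y₂ + f y₃ + f y₄)
          ≡⟨ interleave (y₂ % m) (y₃ % m) (y₄ % m) (f y₂) (f y₃) (f y₄) ⟩
        (y₂ % m + f y₂) + ((y₃ % m + f y₃) + ((y₄ % m + f y₄) + 0))
          ≡⟨ cong₂ _+_ (r+f≡m y₂) (cong₂ _+_ (r+f≡m y₃) (cong (_+ 0) (r+f≡m y₄))) ⟩
        3 * m         ≡⟨ ΣT%m≡3m ⟨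
        5 % m + Σr    ≡⟨ cong (_+ Σr) (m<n⇒m%n≡m 5<m) ⟩
        5 + Σr        ≡⟨ +-comm 5 Σr ⟩
        Σr + 5        ∎)
        where
        open ≡-Reasoning
        Σr = y₂ % m + (y₃ % m + (y₄ % m + 0))
        r+f≡m : ∀ y → y % m + f y ≡ m
        r+f≡m y = m+[n∸m]≡n (m%n≤n y m)
        interleave : ∀ a b c x y z → a + (b + (c + 0)) + (x + y + z) ≡ (a + x) + ((b + y) + ((c + z) + 0))
        interleave = solve-∀

      f₂≤3 : f y₂ ≤ 3
      f₂≤3 = ≤3-of-sum≡5 Σf≡5 (0<f y₃) (0<f y₄)

      f₃≤3 : f y₃ ≤ 3
      f₃≤3 = ≤3-of-sum≡5 (trans (cong (_+ f y₄) (+-comm (f y₃) (f y₂))) Σf≡5) (0<f y₂) (0<f y₄)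

      f₄≤3 : f y₄ ≤ 3
      f₄≤3 = ≤3-of-sum≡5 (trans (+-assoc (f y₄) (f y₂) (f y₃)) (trans (+-comm (f y₄) _) Σf≡5)) (0<f y₂) (0<f y₃)

      Lf≤m : ∀ {L y} → L ≤ 3 → f y ≤ 3 → L * f y ≤ m
      Lf≤m L≤3 f≤3 = ≤-trans (*-mono-≤ L≤3 f≤3) (≤-trans (m≤n+m 9 6) (<⇒≤ 15<m))

      L*5<m : ∀ {L} → L ≤ 3 → L * 5 < m
      L*5<m L≤3 = ≤-<-trans (*-monoˡ-≤ 5 L≤3) 15<m

      scaledDigits : ℕ → ℕ → ℕ
      scaledDigits k L = scaledDigit (m % 5) L k (q y₂) (f y₂) + scaledDigit (m % 5) L k (q y₃) (f y₃)
                       + scaledDigit (m % 5) L k (q y₄) (f y₄)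

      remainderSum-scaled : ∀ L → 0 < L → L ≤ 3 → remainderSum (map (L *_) T) ≡ 3 * m
      remainderSum-scaled L 0<L L≤3 = begin
        (L * 5) % m + ((L * y₂) % m + ((L * y₃) % m + ((L * y₄) % m + 0)))
          ≡⟨ cong₂ _+_ (m<n⇒m%n≡m (L*5<m L≤3))
               (cong₂ _+_ (rem f₂≤3) (cong₂ _+_ (rem f₃≤3) (cong (_+ 0) (rem f₄≤3)))) ⟩
        L * 5 + ((m ∸ L * f y₂) + ((m ∸ L * f y₃) + ((m ∸ L * f y₄) + 0)))
          ≡⟨ cong (λ x → L * x + ((m ∸ L * f y₂) + ((m ∸ L * f y₃) + ((m ∸ L * f y₄) + 0)))) Σf≡5 ⟨
        L * (f y₂ + f y₃ + f y₄) + ((m ∸ L * f y₂) + ((m ∸ L * f y₃) + ((m ∸ L * f y₄) + 0)))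
          ≡⟨ interleave L (f y₂) (f y₃) (f y₄) (m ∸ L * f y₂) (m ∸ L * f y₃) (m ∸ L * f y₄) ⟩
        (m ∸ L * f y₂ + L * f y₂) + ((m ∸ L * f y₃ + L * f y₃) + ((m ∸ L * f y₄ + L * f y₄) + 0))
          ≡⟨ cong₂ _+_ (m∸n+n≡m (Lf≤m L≤3 f₂≤3))
               (cong₂ _+_ (m∸n+n≡m (Lf≤m L≤3 f₃≤3)) (cong (_+ 0) (m∸n+n≡m (Lf≤m L≤3 f₄≤3)))) ⟩
        3 * m ∎
        where
        open ≡-Reasoning
        rem : ∀ {y} → f y ≤ 3 → (L * y) % m ≡ m ∸ L * f y
        rem {y} f≤3 = proj₂ (scaled-/-% {y} {q y} {f y} (y+f≡[1+q]m y) L 0<L (0<f y) (Lf≤m L≤3 f≤3))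
        interleave : ∀ L a b c x y z → L * (a + b + c) + (x + (y + (z + 0))) ≡ (x + L * a) + ((y + L * b) + ((z + L * c) + 0))
        interleave = solve-∀

      digitSum-scaled : ∀ k L → 0 < L → L ≤ 3 → digitSum k (map (L *_) T) ≡ scaledDigits k L
      digitSum-scaled k L 0<L L≤3 = begin
        shifted k ((L * 5) / m) (L * 5) + (digit y₂ + (digit y₃ + (digit y₄ + 0)))
          ≡⟨ cong₂ _+_ first (cong₂ _+_ (scaled f₂≤3) (cong₂ _+_ (scaled f₃≤3) (cong (_+ 0) (scaled f₄≤3)))) ⟩
        0 + (scaled-digit y₂ + (scaled-digit y₃ + (scaled-digit y₄ + 0)))
          ≡⟨ regroup (scaled-digit y₂) (scaled-digit y₃) (scaled-digit y₄) ⟩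
        scaledDigits k L ∎
        where
        open ≡-Reasoning
        digit : ℕ → ℕ
        digit y = shifted k ((L * y) / m) (L * y)
        first : shifted k ((L * 5) / m) (L * 5) ≡ 0
        first = trans (cong (λ a → shifted k a (L * 5)) (m<n⇒m/n≡0 (L*5<m L≤3)))
                      (trans (cong (_% 5) (sym (*-assoc k L 5))) (m*n%n≡0 (k * L) 5))
        scaled-digit : ℕ → ℕ
        scaled-digit y = scaledDigit (m % 5) L k (q y) (f y)
        scaled : ∀ {y} → f y ≤ 3 → digit y ≡ scaled-digit y
        scaled {y} f≤3 =
          shifted-scaled {y} {q y} {f y} (y+f≡[1+q]m y) k L 0<L (0<f y) (≤-trans f≤3 (m≤n+m 3 2)) (Lf≤m L≤3 f≤3)
        regroup : ∀ a b c → 0 + (a + (b + (c + 0))) ≡ a + b + c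
        regroup = solve-∀

      sum-residues-scaled : ∀ k L → 0 < L → L ≤ 3 →
        sum (residues (m * 5) ((1 + k * m) * L) T) ≡ (scaledDigits k L + 3) * m
      sum-residues-scaled k L 0<L L≤3 = begin
        sum (residues (m * 5) ((1 + k * m) * L) T)        ≡⟨ cong sum (residues-* {m * 5} (1 + k * m) L T) ⟩
        sum (residues (m * 5) (1 + k * m) (map (L *_) T)) ≡⟨ sum-residues-shift k (map (L *_) T) ⟩
        digitSum k (map (L *_) T) * m + remainderSum (map (L *_) T)
          ≡⟨ cong₂ (λ a b → a * m + b) (digitSum-scaled k L 0<L L≤3) (remainderSum-scaled L 0<L L≤3) ⟩
        scaledDigits k L * m + 3 * m                      ≡⟨ *-distribʳ-+ m (scaledDigits k L) 3 ⟨
        (scaledDigits k L + 3) * m                        ∎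
        where open ≡-Reasoning

      unit-when-R≡3 : ∃[ U ] (Invertible (m * 5) U × sum (residues (m * 5) U T) ≢ 2 * (m * 5))
      unit-when-R≡3 =
        let l , l<3 , k , _ , admissible , digits≢7 =
              scaled-search (m%n<n m 5) (q<5 y₂<m*5) (q<5 y₃<m*5) (q<5 y₄<m*5) (s≤s f₂≤3) (s≤s f₃≤3) (s≤s f₄≤3)
                            m%5≢0 (>⇒≢ (0<f y₂)) (>⇒≢ (0<f y₃)) (>⇒≢ (0<f y₄)) Σf≡5
        in (1 + k * m) * suc l , invertible-* (invertible-shift k admissible) (invertible-small l l<3) ,
           λ Σ≡2n → digits≢7 (+-cancelʳ-≡ 3 _ 7 (*-cancelʳ-≡ _ 10 m
             (trans (sym (sum-residues-scaled k (suc l) z<s l<3)) (trans Σ≡2n (2*[m*5] m)))))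
        where
        q<5 : ∀ {y} → y < m * 5 → q y < 5
        q<5 {y} y<m*5 = m<n*o⇒m/o<n (subst (y <_) (*-comm m 5) y<m*5)
        2*[m*5] : ∀ m → 2 * (m * 5) ≡ 10 * m
        2*[m*5] = solve-∀

    unit-avoiding-2n : ∃[ U ] (Invertible (m * 5) U × sum (residues (m * 5) U T) ≢ 2 * (m * 5))
    unit-avoiding-2n with multiple<4n ΣT%m≡0 0<ΣT%m ΣT%m<4m
      where
      ΣT%m≡0 : remainderSum T ≡[ m ] 0
      ΣT%m≡0 = trans (sum-map-% T) (trans (sym (m∣n⇒o%n%m≡o%m m (m * 5) (sum T) (m∣m*n 5)))
                 (trans (cong (_% m) ΣT≡0) (m∣n⇒o%n%m≡o%m m (m * 5) 0 (m∣m*n 5))))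
      0<ΣT%m : 0 < remainderSum T
      0<ΣT%m = ≤-trans (subst (0 <_) (sym (m<n⇒m%n≡m 5<m)) z<s) (m≤m+n (5 % m) _)
      ΣT%m<4m : remainderSum T < 4 * m
      ΣT%m<4m = +-mono-< (m%n<n 5 m) (+-mono-< (m%n<n y₂ m) (+-mono-< (m%n<n y₃ m) (+-monoˡ-< 0 (m%n<n y₄ m))))
    ... | inj₁ ΣT%m≡m = unit-when-R≤2 1 z<s (s≤s z≤n) (trans ΣT%m≡m (sym (*-identityˡ m)))
    ... | inj₂ (inj₁ ΣT%m≡2m) = unit-when-R≤2 2 z<s ≤-refl ΣT%m≡2m
    ... | inj₂ (inj₂ ΣT%m≡3m) = unit-when-R≡3 ΣT%m≡3m

  ∣m*5⇒∣m : ∀ {p} → Prime p → p ≢ 5 → p ∣ m * 5 → p ∣ m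
  ∣m*5⇒∣m p-prime p≢5 p∣m*5 with euclidsLemma m 5 p-prime p∣m*5
  ... | inj₁ p∣m = p∣m
  ... | inj₂ p∣5 with prime⇒irreducible (from-yes (prime? 5)) p∣5
  ...   | inj₁ p≡1 = contradiction (subst Prime p≡1 p-prime) ¬prime[1]
  ...   | inj₂ p≡5 = contradiction p≡5 p≢5

  module _ (m*5⊥6 : Coprime (m * 5) 6) where

    2∤m : ¬ 2 ∣ m
    2∤m 2∣m = contradiction (m*5⊥6 (∣m⇒∣m*n 5 2∣m , divides 3 refl)) λ ()

    3∤m : ¬ 3 ∣ m
    3∤m 3∣m = contradiction (m*5⊥6 (∣m⇒∣m*n 5 3∣m , divides 2 refl)) λ ()

    prime∣m⇒7≤ : ∀ {p} → Prime p → p ∣ m → p ≢ 5 → 7 ≤ p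
    prime∣m⇒7≤ {0} p-prime _ _ = contradiction p-prime ¬prime[0]
    prime∣m⇒7≤ {1} p-prime _ _ = contradiction p-prime ¬prime[1]
    prime∣m⇒7≤ {2} _ 2∣m _ = contradiction 2∣m 2∤m
    prime∣m⇒7≤ {3} _ 3∣m _ = contradiction 3∣m 3∤m
    prime∣m⇒7≤ {4} p-prime _ _ = contradiction p-prime (composite⇒¬prime composite[4])
    prime∣m⇒7≤ {5} _ _ p≢5 = contradiction refl p≢5
    prime∣m⇒7≤ {6} p-prime _ _ = contradiction p-prime (composite⇒¬prime composite[6])
    prime∣m⇒7≤ {suc (suc (suc (suc (suc (suc (suc _))))))} _ _ _ = s≤s (s≤s (s≤s (s≤s (s≤s (s≤s (s≤s z≤n))))))

    -- m = t P with t ∉ {0, 1, 2}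
    15<m-of-two-primes : ∀ {P Q} → Prime P → Prime Q → P ≢ Q → P ≢ 5 → P ∣ m → Q ∣ m → 15 < m
    15<m-of-two-primes _ _ _ _ (divides 0 m≡0) _ = contradiction m≡0 (≢-nonZero⁻¹ m)
    15<m-of-two-primes {P} {Q} P-prime Q-prime P≢Q _ (divides 1 m≡P) Q∣m
      with prime⇒irreducible P-prime (subst (Q ∣_) (trans m≡P (+-identityʳ P)) Q∣m)
    ... | inj₁ Q≡1 = contradiction (subst Prime Q≡1 Q-prime) ¬prime[1]
    ... | inj₂ Q≡P = contradiction (sym Q≡P) P≢Q
    15<m-of-two-primes {P} _ _ _ _ (divides 2 m≡2P) _ = contradiction (divides P (trans m≡2P (*-comm 2 P))) 2∤m
    15<m-of-two-primes P-prime _ _ P≢5 P∣m@(divides (suc (suc (suc t))) m≡tP) _ =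
      subst (15 <_) (sym m≡tP)
        (≤-trans (m≤n+m 16 5) (*-mono-≤ (s≤s (s≤s (s≤s (z≤n {t})))) (prime∣m⇒7≤ P-prime P∣m P≢5)))

    15<m : AtLeastThreePrimeFactors (m * 5) → 15 < m
    15<m (p , q , r , p-prime , q-prime , r-prime , p≢q , q≢r , p≢r , p∣m*5 , q∣m*5 , r∣m*5) with p ≟ 5 | q ≟ 5
    ... | yes refl | _ =
      15<m-of-two-primes q-prime r-prime q≢r (≢-sym p≢q)
        (∣m*5⇒∣m q-prime (≢-sym p≢q) q∣m*5) (∣m*5⇒∣m r-prime (≢-sym p≢r) r∣m*5)
    ... | no p≢5 | yes refl =
      15<m-of-two-primes p-prime r-prime p≢r p≢5 (∣m*5⇒∣m p-prime p≢5 p∣m*5) (∣m*5⇒∣m r-prime (≢-sym q≢r) r∣m*5)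
    ... | no p≢5 | no q≢5 =
      15<m-of-two-primes p-prime q-prime p≢q p≢5 (∣m*5⇒∣m p-prime p≢5 p∣m*5) (∣m*5⇒∣m q-prime q≢5 q∣m*5)

index-one : ∀ {n} .{{_ : NonZero n}} → 5 ∣ n → Coprime n 6 → AtLeastThreePrimeFactors n → ¬ 25 ∣ n →
  ∀ {x₁ x₂ x₃ x₄} → All (λ s → s % n ≢ 0) (x₁ ∷ x₂ ∷ x₃ ∷ x₄ ∷ []) →
  ZeroSum n (x₁ ∷ x₂ ∷ x₃ ∷ x₄ ∷ []) →
  gcd n x₁ ≡ 5 → ¬ 5 ∣ x₂ → ¬ 5 ∣ x₃ → ¬ 5 ∣ x₄ → IndIsOne n (x₁ ∷ x₂ ∷ x₃ ∷ x₄ ∷ [])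
index-one (divides m refl) m*5⊥6 three 25∤m*5 {x₁} {x₂} {x₃} {x₄} S≢0 ΣS≡0 gcd[m*5,x₁]≡5 5∤x₂ 5∤x₃ 5∤x₄ =
  normalise (normalising-unit m 1<m m%5≢0′ gcd[m*5,x₁]≡5)
  where
  instance
    m≢0 : NonZero m
    m≢0 = m*n≢0⇒m≢0 m
  S = x₁ ∷ x₂ ∷ x₃ ∷ x₄ ∷ []
  m%5≢0′ = m%5≢0 m 25∤m*5
  15<m′ = 15<m m m*5⊥6 three
  1<m : 1 < m
  1<m = ≤-trans (s≤s (s≤s z≤n)) (<⇒≤ 15<m′)
  normalise : ∃[ u ] (Invertible (m * 5) u × u * x₁ % (m * 5) ≡ 5) → IndIsOne (m * 5) S
  normalise (u , u-inv , ux₁≡5) = conclude (unit-avoiding-2n m 15<m′ m%5≢0′ (2∤m m m*5⊥6) (3∤m m m*5⊥6)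
      (m%n<n (u * x₂) (m * 5)) (m%n<n (u * x₃) (m * 5)) (m%n<n (u * x₄) (m * 5))
      (5∤-residue m u-inv 5∤x₂) (5∤-residue m u-inv 5∤x₃) (5∤-residue m u-inv 5∤x₄)
      (subst (ZeroSum (m * 5)) uS≡S′ (zeroSum-residues {m * 5} u {S = S} ΣS≡0)))
    where
    S′ = 5 ∷ u * x₂ % (m * 5) ∷ u * x₃ % (m * 5) ∷ u * x₄ % (m * 5) ∷ []
    uS≡S′ : residues (m * 5) u S ≡ S′
    uS≡S′ = cong (_∷ _) ux₁≡5
    conclude : ∃[ U ] (Invertible (m * 5) U × sum (residues (m * 5) U S′) ≢ 2 * (m * 5)) → IndIsOne (m * 5) S
    conclude (U , U-inv , ΣS′≢2n) =
      indIsOne-of-residues≢2n (≤-trans 1<m (m≤m*n m 5)) ΣS≡0 S≢0 (invertible-* U-inv u-inv) λ Σ≡2n →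
        ΣS′≢2n (trans (cong sum (trans (cong (residues (m * 5) U) (sym uS≡S′)) (residues-∘ {m * 5} U u S))) Σ≡2n)

lemma2p6 : (n : ℕ) .{{_ : NonZero n}} →
  gcd n 6 ≡ 1 → AtLeastThreePrimeFactors n →
  (x₁ x₂ x₃ x₄ : ℕ) →
  1 ≤ x₁ × x₁ ≤ n ∸ 1 → 1 ≤ x₂ × x₂ ≤ n ∸ 1 →
  1 ≤ x₃ × x₃ ≤ n ∸ 1 → 1 ≤ x₄ × x₄ ≤ n ∸ 1 →
  gcd n (gcd x₁ (gcd x₂ (gcd x₃ x₄))) ≡ 1 →
  MinimalZeroSum n (x₁ ∷ x₂ ∷ x₃ ∷ x₄ ∷ []) →
  gcd n x₁ ≡ 5 →
  gcd 5 (gcd n x₂) ≡ 1 → gcd 5 (gcd n x₃) ≡ 1 → gcd 5 (gcd n x₄) ≡ 1 →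
  ¬ (25 ∣ n) →
  IndIsOne n (x₁ ∷ x₂ ∷ x₃ ∷ x₄ ∷ [])
lemma2p6 n gcd[n,6]≡1 three x₁ x₂ x₃ x₄ x₁-range x₂-range x₃-range x₄-range _ (_ , ΣS≡0 , _)
         gcd[n,x₁]≡5 gcd[5,gcd[n,x₂]]≡1 gcd[5,gcd[n,x₃]]≡1 gcd[5,gcd[n,x₄]]≡1 25∤n =
  -- of the minimality of S only the zero sum is needed
  index-one 5∣n (gcd≡1⇒coprime gcd[n,6]≡1) three 25∤n
    (%≢0-of-bounds x₁-range ∷ %≢0-of-bounds x₂-range ∷ %≢0-of-bounds x₃-range ∷ %≢0-of-bounds x₄-range ∷ [])
    ΣS≡0 gcd[n,x₁]≡5 (5∤ gcd[5,gcd[n,x₂]]≡1) (5∤ gcd[5,gcd[n,x₃]]≡1) (5∤ gcd[5,gcd[n,x₄]]≡1)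
  where
  5∣n : 5 ∣ n
  5∣n = subst (_∣ n) gcd[n,x₁]≡5 (gcd[m,n]∣m n x₁)
  5∤ : ∀ {x} → gcd 5 (gcd n x) ≡ 1 → ¬ 5 ∣ x
  5∤ = ∤-of-gcd≡1 (λ ()) 5∣n
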